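{- For each integer $k\ge 2$, the graph $\Theta(2,2,2k)$ is chromatic-choosable (its list chromatic number equals its chromatic number, $2$), but it is not weakly enumeratively chromatic-choosable, i.e. $P_\ell(\Theta(2,2,2k),2)<P(\Theta(2,2,2k),2)$.
   Context: $\Theta(l_1,l_2,l_3)$ is the graph consisting of two end vertices joined by three internally disjoint paths of lengths $l_1,l_2,l_3$. For a list assignment $L$, $P(G,L)$ is the number of proper colorings $f$ with $f(v)\in L(v)$; $P_\ell(G,m)$ is the minimum of $P(G,L)$ over all assignments with $|L(v)|=m$ for all $v$; $P(G,m)$ is the chromatic polynomial. Weakly enumeratively chromatic-choosable means $P_\ell(G,\chi(G))=P(G,\chi(G))$. -}

module Defs where

open import Data.Nat using (ℕ; zero; suc; _+_; _∸_; _<_; _≟_)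
open import Data.Fin using (Fin; zero; suc)
open import Data.Vec using (Vec; []; _∷_; lookup)
open import Data.List using (List; []; _∷_; [_]; map; concatMap; upTo; length; filter)
open import Data.List.Relation.Unary.All using (All; all?)
open import Data.List.Relation.Unary.Unique.Propositional using (Unique)
open import Data.List.Membership.Propositional using (_∈_)
open import Data.Product using (Σ; _×_; _,_; ∃-syntax)
open import Relation.Nullary using (¬_; Dec; ¬?)
open import Relation.Binary.PropositionalEquality using (_≡_; _≢_)

record Graph : Set where
  field
    n     : ℕ
    edges : List (Fin n × Fin n)
open Graph public

-- ℕ → Fin (suc m), clamping (only ever used with in-range indices).
fin : ∀ {m} → ℕ → Fin (suc m)
fin {zero}  _       = zero
fin {suc m} zero    = zero
fin {suc m} (suc i) = suc (fin i)

pathEdges : ∀ {n} → Fin n → List (Fin n) → Fin n → List (Fin n × Fin n)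
pathEdges s []       t = (s , t) ∷ []
pathEdges s (x ∷ xs) t = (s , x) ∷ pathEdges x xs t

-- Θ(l₁,l₂,l₃): end vertices 0 and 1, joined by three internally disjoint
-- paths of lengths l₁,l₂,l₃ (each lᵢ ≥ 1); the internal vertices of path i
-- form a consecutive block of lᵢ - 1 vertices.
Theta : ℕ → ℕ → ℕ → Graph
Theta l₁ l₂ l₃ = record { n = N ; edges = es }
  where
    N : ℕ
    N = 2 + (l₁ ∸ 1) + (l₂ ∸ 1) + (l₃ ∸ 1)
    block : ℕ → ℕ → List (Fin N)
    block s l = map (λ i → fin (s + i)) (upTo (l ∸ 1))
    s₁ s₂ s₃ : ℕ
    s₁ = 2
    s₂ = s₁ + (l₁ ∸ 1)
    s₃ = s₂ + (l₂ ∸ 1)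
    u v : Fin N
    u = fin 0
    v = fin 1
    es : List (Fin N × Fin N)
    es = pathEdges u (block s₁ l₁) v Data.List.++ (pathEdges u (block s₂ l₂) v Data.List.++ pathEdges u (block s₃ l₃) v)

Coloring : Graph → Set
Coloring G = Vec ℕ (n G)

Proper : (G : Graph) → Coloring G → Set
Proper G f = All (λ e → lookup f (Data.Product.proj₁ e) ≢ lookup f (Data.Product.proj₂ e)) (edges G)

proper? : (G : Graph) → (f : Coloring G) → Dec (Proper G f)
proper? G f = all? (λ e → ¬? (lookup f (Data.Product.proj₁ e) ≟ lookup f (Data.Product.proj₂ e))) (edges G)

ListAssignment : Graph → Set
ListAssignment G = Fin (n G) → List ℕ

IsAssignmentOfSize : (G : Graph) → ℕ → ListAssignment G → Set
IsAssignmentOfSize G m L = ∀ v → length (L v) ≡ m × Unique (L v)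

choices : ∀ {k} → (Fin k → List ℕ) → List (Vec ℕ k)
choices {zero}  L = [ [] ]
choices {suc k} L = concatMap (λ c → map (c ∷_) (choices (λ i → L (suc i)))) (L zero)

P-list : (G : Graph) → ListAssignment G → ℕ
P-list G L = length (filter (proper? G) (choices L))

P : Graph → ℕ → ℕ
P G m = P-list G (λ _ → upTo m)

IsLColorable : (G : Graph) → ListAssignment G → Set
IsLColorable G L = Σ (Coloring G) λ f → (∀ v → lookup f v ∈ L v) × Proper G f

Colorable : Graph → ℕ → Set
Colorable G m = IsLColorable G (λ _ → upTo m)

Choosable : Graph → ℕ → Set
Choosable G m = ∀ L → IsAssignmentOfSize G m L → IsLColorable G L

IsChromaticNumber : Graph → ℕ → Set
IsChromaticNumber G m = Colorable G m × (∀ j → j < m → ¬ Colorable G j)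

IsListChromaticNumber : Graph → ℕ → Set
IsListChromaticNumber G m = Choosable G m × (∀ j → j < m → ¬ Choosable G j)

-- P_ℓ(G,m) < c  (the minimum over m-assignments is below c)
PℓBelow : Graph → ℕ → ℕ → Set
PℓBelow G m c = ∃[ L ] (IsAssignmentOfSize G m L × P-list G L < c)

{-# OPTIONS --safe #-}
module Submission where

-- Colour the internal vertices of a u–v path with 2-lists one at a time, starting next to u.  Either
-- some vertex is not forced, and then v may receive any colour, or every vertex is forced and exactly
-- one colour is excluded at v.  The excluded colour depends injectively on the colour of u, and along a
-- path with an odd number of internal vertices (all three paths of Θ(2,2,2k)) the two colours of L(u)
-- are exchanged whenever both are forced.  A short case analysis then finds colours of u and v excluded
-- by none of the three paths, so Θ(2,2,2k) is 2-choosable.  On the other hand, the lists u:12, v:13,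
-- a:12, b:23 on the short paths and 12,23,31,12,12,… on the long path admit exactly one colouring,
-- whereas exchanging the two colours of a 2-colouring always gives a second one.

open import Defs
open import Data.Nat using (ℕ; zero; suc; _+_; _*_; _≤_; _≟_; z≤n; s≤s)
open import Data.Nat.Properties using (*-suc; m≤n⇒m≤1+n; <-≤-trans)
open import Data.Fin using (Fin; zero; suc)
open import Data.Vec using (Vec; []; _∷_; lookup; toList)
import Data.Vec as Vec
open import Data.Vec.Properties using (∷-injective; lookup-map)
open import Data.List
  using (List; []; _∷_; map; upTo; applyUpTo; filter; length; concatMap; cartesianProductWith; _++_)
open import Data.List.Properties using (map-∘; map-applyUpTo; length-upTo)
open import Data.List.Relation.Unary.All using (All; []; _∷_)
import Data.List.Relation.Unary.All as All
open import Data.List.Relation.Unary.Any using (here; there)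
open import Data.List.Relation.Unary.AllPairs using ([]; _∷_)
open import Data.List.Relation.Unary.Unique.Propositional using (Unique)
open import Data.List.Relation.Unary.Unique.Propositional.Properties
  using (cartesianProductWith⁺; filter⁺; upTo⁺)
open import Data.List.Membership.Propositional using (_∈_)
open import Data.List.Membership.DecPropositional _≟_ using (_∈?_)
open import Data.List.Membership.Propositional.Properties
  using (∈-cartesianProductWith⁺; ∈-cartesianProductWith⁻; ∈-filter⁺; ∈-filter⁻)
open import Data.Maybe using (Maybe; just; nothing; _>>=_)
open import Data.Maybe.Properties using (just-injective) renaming (≡-dec to ≡-dec-Maybe)
open import Data.Product using (Σ; ∃-syntax; _×_; _,_; proj₁; proj₂; swap)
open import Function using (_∘_; case_of_; _⇔_; mk⇔; Equivalence)
open import Relation.Binary.Definitions using (DecidableEquality)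
open import Relation.Nullary using (¬_; yes; no; contradiction)
open import Relation.Binary.PropositionalEquality

-- List colourings of arbitrary graphs

concatMap-cartesianProductWith : ∀ {A B C : Set} (f : A → B → C) xs ys →
  concatMap (λ x → map (f x) ys) xs ≡ cartesianProductWith f xs ys
concatMap-cartesianProductWith f []       ys = refl
concatMap-cartesianProductWith f (x ∷ xs) ys = cong (map (f x) ys ++_) (concatMap-cartesianProductWith f xs ys)

choices-cartesianProduct : ∀ {k} (L : Fin (suc k) → List ℕ) →
  choices L ≡ cartesianProductWith _∷_ (L zero) (choices (L ∘ suc))
choices-cartesianProduct L = concatMap-cartesianProductWith _∷_ (L zero) (choices (L ∘ suc))

∈-choices⁺ : ∀ {k} (L : Fin k → List ℕ) {x} → (∀ i → lookup x i ∈ L i) → x ∈ choices L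
∈-choices⁺ {zero}  L {[]}    _   = here refl
∈-choices⁺ {suc k} L {c ∷ x} x∈ rewrite choices-cartesianProduct L =
  ∈-cartesianProductWith⁺ _∷_ (x∈ zero) (∈-choices⁺ (L ∘ suc) (x∈ ∘ suc))

∈-choices⁻ : ∀ {k} (L : Fin k → List ℕ) {x} → x ∈ choices L → ∀ i → lookup x i ∈ L i
∈-choices⁻ {suc k} L x∈ i rewrite choices-cartesianProduct L
  with ∈-cartesianProductWith⁻ _∷_ (L zero) (choices (L ∘ suc)) x∈
∈-choices⁻ {suc k} L x∈ zero    | c , y , c∈ , y∈ , refl = c∈
∈-choices⁻ {suc k} L x∈ (suc i) | c , y , c∈ , y∈ , refl = ∈-choices⁻ (L ∘ suc) y∈ i

choices-unique : ∀ {k} (L : Fin k → List ℕ) → (∀ i → Unique (L i)) → Unique (choices L)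
choices-unique {zero}  L _ = [] ∷ []
choices-unique {suc k} L u rewrite choices-cartesianProduct L =
  cartesianProductWith⁺ _∷_ ∷-injective (u zero) (choices-unique (L ∘ suc) (u ∘ suc))

LColoring : (G : Graph) → ListAssignment G → Coloring G → Set
LColoring G L f = (∀ v → lookup f v ∈ L v) × Proper G f

properChoices : (G : Graph) → ListAssignment G → List (Coloring G)
properChoices G L = filter (proper? G) (choices L)

∈-properChoices⁺ : ∀ G L {f} → LColoring G L f → f ∈ properChoices G L
∈-properChoices⁺ G L (f∈ , proper) = ∈-filter⁺ (proper? G) (∈-choices⁺ L f∈) proper

∈-properChoices⁻ : ∀ G L {f} → f ∈ properChoices G L → LColoring G L f
∈-properChoices⁻ G L f∈ = let c∈ , proper = ∈-filter⁻ (proper? G) f∈ in ∈-choices⁻ L c∈ , proper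

length≤1 : ∀ {A : Set} {xs : List A} → Unique xs → (∀ {x y} → x ∈ xs → y ∈ xs → x ≡ y) → length xs ≤ 1
length≤1 {xs = []}        _               _    = z≤n
length≤1 {xs = _ ∷ []}    _               _    = s≤s z≤n
length≤1 {xs = _ ∷ _ ∷ _} ((x≢y ∷ _) ∷ _) same = contradiction (same (here refl) (there (here refl))) x≢y

2≤length : ∀ {A : Set} {xs : List A} {x y} → x ∈ xs → y ∈ xs → x ≢ y → 2 ≤ length xs
2≤length (here refl) (here refl) x≢y = contradiction refl x≢y
2≤length {xs = _ ∷ _ ∷ _} (here _)  (there _) _ = s≤s (s≤s z≤n)
2≤length {xs = _ ∷ _ ∷ _} (there _) (here _)  _ = s≤s (s≤s z≤n)
2≤length (there x∈) (there y∈) x≢y = m≤n⇒m≤1+n (2≤length x∈ y∈ x≢y)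

P-list≤1 : ∀ G L → (∀ v → Unique (L v)) → (∀ {f g} → LColoring G L f → LColoring G L g → f ≡ g) →
  P-list G L ≤ 1
P-list≤1 G L u same = length≤1 (filter⁺ (proper? G) (choices-unique L u))
  (λ f∈ g∈ → same (∈-properChoices⁻ G L f∈) (∈-properChoices⁻ G L g∈))

2≤P-list : ∀ G L {f g} → LColoring G L f → LColoring G L g → f ≢ g → 2 ≤ P-list G L
2≤P-list G L f-col g-col = 2≤length (∈-properChoices⁺ G L f-col) (∈-properChoices⁺ G L g-col)

flip01 : ℕ → ℕ
flip01 0             = 1
flip01 1             = 0
flip01 (suc (suc c)) = suc (suc c)

flip01-involutive : ∀ c → flip01 (flip01 c) ≡ c
flip01-involutive 0             = refl
flip01-involutive 1             = refl
flip01-involutive (suc (suc c)) = refl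

flip01-injective : ∀ {c c'} → flip01 c ≡ flip01 c' → c ≡ c'
flip01-injective {c} {c'} eq = trans (sym (flip01-involutive c)) (trans (cong flip01 eq) (flip01-involutive c'))

flip01-∈ : ∀ {c} → c ∈ upTo 2 → flip01 c ∈ upTo 2
flip01-∈ (here refl)         = there (here refl)
flip01-∈ (there (here refl)) = here refl

flip01-moves : ∀ {c} → c ∈ upTo 2 → flip01 c ≢ c
flip01-moves (here refl)         ()
flip01-moves (there (here refl)) ()

flip01-coloring : ∀ G {f} → LColoring G (λ _ → upTo 2) f → LColoring G (λ _ → upTo 2) (Vec.map flip01 f)
flip01-coloring G {f} (f∈ , proper) =
  (λ v → subst (_∈ upTo 2) (sym (lookup-map v flip01 f)) (flip01-∈ (f∈ v))) ,
  All.map (λ {e} u≢v eq → u≢v (flip01-injective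
    (trans (sym (lookup-map (proj₁ e) flip01 f)) (trans eq (lookup-map (proj₂ e) flip01 f))))) proper

2≤P : ∀ G → Fin (n G) → Colorable G 2 → 2 ≤ P G 2
2≤P G v (f , col) = 2≤P-list G (λ _ → upTo 2) {f} {Vec.map flip01 f} col (flip01-coloring G {f} col)
  λ f≡f′ → flip01-moves (proj₁ col v)
             (trans (sym (lookup-map v flip01 f)) (sym (cong (λ g → lookup g v) f≡f′)))

¬colorable-0 : ∀ G → Fin (n G) → ¬ Colorable G 0
¬colorable-0 G v (f , f∈ , _) with f∈ v
... | ()

¬colorable-1 : ∀ G {u v} → (u , v) ∈ edges G → ¬ Colorable G 1
¬colorable-1 G uv∈ (f , f∈ , proper) with f∈ _ | f∈ _
... | here u0 | here v0 = All.lookup proper uv∈ (trans u0 (sym v0))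

choosable⇒colorable : ∀ G {m} → Choosable G m → Colorable G m
choosable⇒colorable G {m} choosable = choosable (λ _ → upTo m) (λ _ → length-upTo m , upTo⁺ m)

chromatic-number-2 : ∀ G {u v} → (u , v) ∈ edges G → Colorable G 2 → IsChromaticNumber G 2
chromatic-number-2 G {u} uv∈ colorable = colorable , λ
  { 0 _ → ¬colorable-0 G u
  ; 1 _ → ¬colorable-1 G uv∈
  ; (suc (suc _)) (s≤s (s≤s ())) }

list-chromatic-number-2 : ∀ G {u v} → (u , v) ∈ edges G → Choosable G 2 → IsListChromaticNumber G 2
list-chromatic-number-2 G {u} uv∈ choosable = choosable , λ
  { 0 _ → ¬colorable-0 G u ∘ choosable⇒colorable G
  ; 1 _ → ¬colorable-1 G uv∈ ∘ choosable⇒colorable G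
  ; (suc (suc _)) (s≤s (s≤s ())) }

-- Paths with two-element lists

_≟ₘ_ : DecidableEquality (Maybe ℕ)
_≟ₘ_ = ≡-dec-Maybe _≟_

Pair : Set
Pair = ℕ × ℕ

⟦_⟧ : Pair → List ℕ
⟦ p , q ⟧ = p ∷ q ∷ []

Distinct : Pair → Set
Distinct (p , q) = p ≢ q

pair-unique : ∀ {P} → Distinct P → Unique ⟦ P ⟧
pair-unique p≢q = (p≢q ∷ []) ∷ [] ∷ []

pair-other-unique : ∀ {P x y z} → x ∈ ⟦ P ⟧ → y ∈ ⟦ P ⟧ → z ∈ ⟦ P ⟧ → x ≢ y → x ≢ z → y ≡ z
pair-other-unique (here refl)         (here refl)         _                   x≢y _   = contradiction refl x≢y
pair-other-unique (here refl)         _                   (here refl)         _   x≢z = contradiction refl x≢z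
pair-other-unique (here refl)         (there (here refl)) (there (here refl)) _   _   = refl
pair-other-unique (there (here refl)) (here refl)         (here refl)         _   _   = refl
pair-other-unique (there (here refl)) (there (here refl)) _                   x≢y _   = contradiction refl x≢y
pair-other-unique (there (here refl)) _                   (there (here refl)) _   x≢z = contradiction refl x≢z

∈-swap : ∀ {P x} → x ∈ ⟦ P ⟧ → x ∈ ⟦ swap P ⟧
∈-swap (here refl)         = there (here refl)
∈-swap (there (here refl)) = here refl

as-pair : ∀ {l} → length l ≡ 2 × Unique l → Σ Pair λ P → Distinct P × l ≡ ⟦ P ⟧
as-pair {x ∷ y ∷ []} (refl , (x≢y ∷ []) ∷ _) = (x , y) , x≢y , refl

choosable-by-pairs : ∀ G →
  (∀ (Ps : Fin (n G) → Pair) → (∀ v → Distinct (Ps v)) → IsLColorable G (⟦_⟧ ∘ Ps)) → Choosable G 2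
choosable-by-pairs G colorable L sizes =
  let f , f∈ , proper = colorable (proj₁ ∘ pair) (proj₁ ∘ proj₂ ∘ pair)
  in f , (λ v → subst (lookup f v ∈_) (sym (proj₂ (proj₂ (pair v)))) (f∈ v)) , proper
  where
    pair : ∀ v → Σ Pair λ P → Distinct P × L v ≡ ⟦ P ⟧
    pair v = as-pair (sizes v)

forced : Pair → ℕ → Maybe ℕ
forced (p , q) c with c ≟ p | c ≟ q
... | yes _ | _     = just q
... | no _  | yes _ = just p
... | no _  | no _  = nothing

module _ {P : Pair} (dP : Distinct P) where

  forced-just : ∀ {c d} → forced P c ≡ just d → c ∈ ⟦ P ⟧ × d ∈ ⟦ P ⟧ × c ≢ d
  forced-just {c} eq with c ≟ proj₁ P | c ≟ proj₂ P
  forced-just refl | yes refl | _        = here refl , there (here refl) , dP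
  forced-just refl | no _     | yes refl = there (here refl) , here refl , dP ∘ sym

  forced-irreflexive : ∀ {c} → forced P c ≢ just c
  forced-irreflexive eq = proj₂ (proj₂ (forced-just eq)) refl

  forced-unique : ∀ {c d x} → forced P c ≡ just d → x ∈ ⟦ P ⟧ → c ≢ x → x ≡ d
  forced-unique eq x∈ c≢x = let c∈ , d∈ , c≢d = forced-just eq in pair-other-unique c∈ x∈ d∈ c≢x c≢d

  forced-injective : ∀ {c c' d} → forced P c ≡ just d → forced P c' ≡ just d → c ≡ c'
  forced-injective eq eq' =
    let c∈ , d∈ , c≢d = forced-just eq ; c'∈ , _ , c'≢d = forced-just eq'
    in pair-other-unique d∈ c∈ c'∈ (c≢d ∘ sym) (c'≢d ∘ sym)

  forced-swaps : ∀ {c c' d d'} → c ≢ c' → forced P c ≡ just d → forced P c' ≡ just d' → (d , d') ≡ (c' , c)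
  forced-swaps c≢c' eq eq' with forced-just eq | forced-just eq'
  ... | c∈ , d∈ , c≢d | c'∈ , d'∈ , c'≢d' =
    cong₂ _,_ (pair-other-unique c∈ d∈ c'∈ c≢d c≢c') (pair-other-unique c'∈ d'∈ c∈ c'≢d' (c≢c' ∘ sym))

forced-nothing : ∀ {P c x} → forced P c ≡ nothing → x ∈ ⟦ P ⟧ → c ≢ x
forced-nothing {p , q} {c} eq x∈ c≡x with c ≟ p | c ≟ q
forced-nothing () (here refl)         refl | yes _ | _
forced-nothing () (there (here refl)) refl | no _  | yes _
forced-nothing _  (here refl)         refl | no c≢p | no _  = c≢p refl
forced-nothing _  (there (here refl)) refl | no _  | no c≢q = c≢q refl

ProperPath : ℕ → List ℕ → ℕ → Set
ProperPath a []       b = a ≢ b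
ProperPath a (x ∷ xs) b = a ≢ x × ProperPath x xs b

ChosenFrom : ∀ {m} → (Fin m → Pair) → Vec ℕ m → Set
ChosenFrom Ls xs = ∀ w → lookup xs w ∈ ⟦ Ls w ⟧

-- The only colour the far end of a path with internal lists Ls cannot take when the near end has
-- colour c; nothing if it can take any colour (forbidden-sound, forbidden-complete).
forbidden : ∀ {m} → (Fin m → Pair) → ℕ → Maybe ℕ
forbidden {zero}  Ls c = just c
forbidden {suc m} Ls c = forced (Ls zero) c >>= forbidden (Ls ∘ suc)

swapⁿ : ℕ → Pair → Pair
swapⁿ zero    P = P
swapⁿ (suc m) P = swapⁿ m (swap P)

Odd : ℕ → Set
Odd m = ∃[ j ] m ≡ suc (2 * j)

swapⁿ-even : ∀ j P → swapⁿ (2 * j) P ≡ P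
swapⁿ-even zero    P = refl
swapⁿ-even (suc j) P = subst (λ n → swapⁿ n P ≡ P) (sym (*-suc 2 j)) (swapⁿ-even j P)

swapⁿ-odd : ∀ {m} → Odd m → ∀ P → swapⁿ m P ≡ swap P
swapⁿ-odd (j , refl) P = swapⁿ-even j (swap P)

odd-3+2* : ∀ t → Odd (3 + 2 * t)
odd-3+2* t = suc t , cong suc (sym (*-suc 2 t))

forbidden-injective : ∀ {m} (Ls : Fin m → Pair) → (∀ w → Distinct (Ls w)) →
  ∀ {c c' d} → forbidden Ls c ≡ just d → forbidden Ls c' ≡ just d → c ≡ c'
forbidden-injective {zero}  Ls dLs refl refl = refl
forbidden-injective {suc m} Ls dLs {c} {c'} eq eq' with forced (Ls zero) c in e | forced (Ls zero) c' in e'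
forbidden-injective {suc m} Ls dLs () eq' | nothing | _
forbidden-injective {suc m} Ls dLs eq () | just _ | nothing
... | just x | just x' with forbidden-injective (Ls ∘ suc) (dLs ∘ suc) eq eq'
...   | refl = forced-injective (dLs zero) e e'

forbidden-swapⁿ : ∀ {m} (Ls : Fin m → Pair) → (∀ w → Distinct (Ls w)) →
  ∀ {c c' d d'} → c ≢ c' → forbidden Ls c ≡ just d → forbidden Ls c' ≡ just d' →
  (d , d') ≡ swapⁿ m (c , c')
forbidden-swapⁿ {zero}  Ls dLs c≢c' refl refl = refl
forbidden-swapⁿ {suc m} Ls dLs {c} {c'} c≢c' eq eq' with forced (Ls zero) c in e | forced (Ls zero) c' in e'
forbidden-swapⁿ {suc m} Ls dLs c≢c' () eq' | nothing | _
forbidden-swapⁿ {suc m} Ls dLs c≢c' eq () | just _ | nothing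
... | just x | just x' with forced-swaps (dLs zero) c≢c' e e'
...   | refl = forbidden-swapⁿ (Ls ∘ suc) (dLs ∘ suc) (c≢c' ∘ sym) eq eq'

PathColoring : ∀ {m} → (Fin m → Pair) → ℕ → ℕ → Set
PathColoring Ls a b = ∃[ xs ] ChosenFrom Ls xs × ProperPath a (toList xs) b

PathColoring-∷ : ∀ {m} {Ls : Fin (suc m) → Pair} {a x b} → x ∈ ⟦ Ls zero ⟧ → a ≢ x →
  PathColoring (Ls ∘ suc) x b → PathColoring Ls a b
PathColoring-∷ {x = x} x∈ a≢x (xs , xs∈ , path) =
  x ∷ xs , (λ { zero → x∈ ; (suc w) → xs∈ w }) , a≢x , path

forbidden-complete : ∀ {m} (Ls : Fin m → Pair) → (∀ w → Distinct (Ls w)) →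
  ∀ {a b} → forbidden Ls a ≢ just b → PathColoring Ls a b
forbidden-complete {zero}  Ls dLs a↛b = [] , (λ ()) , a↛b ∘ cong just
forbidden-complete {suc m} Ls dLs {a} {b} a↛b with forced (Ls zero) a in e
... | just x  = let _ , x∈ , a≢x = forced-just (dLs zero) e
                in PathColoring-∷ x∈ a≢x (forbidden-complete (Ls ∘ suc) (dLs ∘ suc) a↛b)
... | nothing with forbidden (Ls ∘ suc) (proj₁ (Ls zero)) ≟ₘ just b
...   | no  p↛b = PathColoring-∷ (here refl) (forced-nothing e (here refl))
                    (forbidden-complete (Ls ∘ suc) (dLs ∘ suc) p↛b)
...   | yes p→b = PathColoring-∷ (there (here refl)) (forced-nothing e (there (here refl)))
                    (forbidden-complete (Ls ∘ suc) (dLs ∘ suc)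
                      (dLs zero ∘ forbidden-injective (Ls ∘ suc) (dLs ∘ suc) p→b))

forbidden-sound : ∀ {m} (Ls : Fin m → Pair) → (∀ w → Distinct (Ls w)) →
  ∀ {a b} → PathColoring Ls a b → forbidden Ls a ≢ just b
forbidden-sound {zero}  Ls dLs ([] , _ , a≢b) = a≢b ∘ just-injective
forbidden-sound {suc m} Ls dLs {a} (x ∷ xs , xs∈ , a≢x , path) with forced (Ls zero) a in e
... | nothing = λ ()
... | just y  with forced-unique (dLs zero) e (xs∈ zero) a≢x
...   | refl = forbidden-sound (Ls ∘ suc) (dLs ∘ suc) (xs , xs∈ ∘ suc , path)

PathColoring-unique : ∀ {m} (Ls : Fin m → Pair) → (∀ w → Distinct (Ls w)) →
  ∀ {a b b' d} → forbidden Ls a ≡ just d →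
  (p : PathColoring Ls a b) (q : PathColoring Ls a b') → proj₁ p ≡ proj₁ q
PathColoring-unique {zero}  Ls dLs _ ([] , _) ([] , _) = refl
PathColoring-unique {suc m} Ls dLs {a} eq (x ∷ xs , xs∈ , a≢x , path) (y ∷ ys , ys∈ , a≢y , path')
  with forced (Ls zero) a in e
PathColoring-unique {suc m} Ls dLs () _ _ | nothing
... | just z with forced-unique (dLs zero) e (xs∈ zero) a≢x | forced-unique (dLs zero) e (ys∈ zero) a≢y
...   | refl | refl =
  cong (x ∷_) (PathColoring-unique (Ls ∘ suc) (dLs ∘ suc) eq (xs , xs∈ ∘ suc , path) (ys , ys∈ ∘ suc , path'))

forbidden-one : ∀ P c → forbidden (λ (_ : Fin 1) → P) c ≡ forced P c
forbidden-one P c with forced P c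
... | just _  = refl
... | nothing = refl

forced-complete : ∀ {P a b} → Distinct P → forced P a ≢ just b → ∃[ c ] c ∈ ⟦ P ⟧ × ProperPath a (c ∷ []) b
forced-complete {P} {a} dP a↛b
  with forbidden-complete {1} (λ _ → P) (λ _ → dP) (a↛b ∘ trans (sym (forbidden-one P a)))
... | c ∷ [] , c∈ , path = c , c∈ zero , path

forbidden-constant : ∀ n {P c c'} → forced P c ≡ just c' → forced P c' ≡ just c →
  forbidden (λ (_ : Fin n) → P) c ≡ just (proj₁ (swapⁿ n (c , c')))
forbidden-constant zero    e e' = refl
forbidden-constant (suc n) e e' rewrite e = forbidden-constant n e' e

Avoids : (ℕ → Maybe ℕ) → ℕ → Pair → Set
Avoids r x V = ∀ {y} → y ∈ ⟦ V ⟧ → r x ≢ just y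

-- Colours x ∈ U, y ∈ V of the ends u, v of Θ(2,2,m+1) from which the short paths through the
-- vertices with lists A and B, and the long path with forbidding function r, can all be completed.
record AdmissibleEnds (U V A B : Pair) (r : ℕ → Maybe ℕ) : Set where
  constructor ends
  field
    x y   : ℕ
    x∈U   : x ∈ ⟦ U ⟧
    y∈V   : y ∈ ⟦ V ⟧
    A-ok  : forced A x ≢ just y
    B-ok  : forced B x ≢ just y
    r-ok  : r x ≢ just y

avoids-swap : ∀ {r x V} → Avoids r x V → Avoids r x (swap V)
avoids-swap avoids = avoids ∘ ∈-swap

forced-cross : ∀ {X Y u₁ u₂ v₁ v₂} → Distinct X → Distinct Y → u₁ ≢ u₂ →
  forced X u₁ ≡ just v₁ → forced Y u₁ ≡ just v₂ → Avoids (forced X) u₂ (v₁ , v₂)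
forced-cross dX dY u₁≢u₂ Xu₁ Yu₁ (here refl) Xu₂ = u₁≢u₂ (forced-injective dX Xu₁ Xu₂)
forced-cross dX dY u₁≢u₂ Xu₁ Yu₁ (there (here refl)) Xu₂ with forced-swaps dX u₁≢u₂ Xu₁ Xu₂
... | refl = forced-irreflexive dY Yu₁

admissibleEnds-at : ∀ {U V A B r x} → Distinct V → x ∈ ⟦ U ⟧ →
  Avoids (forced A) x V → Avoids (forced B) x V → AdmissibleEnds U V A B r
admissibleEnds-at {V = v₁ , v₂} {r = r} {x} v₁≢v₂ x∈U A-ok B-ok with r x ≟ₘ just v₁
... | yes r→v₁ = ends x v₂ x∈U v₂∈ (A-ok v₂∈) (B-ok v₂∈) (v₁≢v₂ ∘ just-injective ∘ trans (sym r→v₁))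
  where
    v₂∈ : v₂ ∈ ⟦ v₁ , v₂ ⟧
    v₂∈ = there (here refl)
... | no  r↛v₁ = ends x v₁ x∈U (here refl) (A-ok (here refl)) (B-ok (here refl)) r↛v₁

-- If A and B together block both colours of V at u₁, they block one each, and then neither blocks
-- anything at u₂.
admissibleEnds-avoiding : ∀ {U V A B r u₁ u₂} → Distinct V → Distinct A → Distinct B →
  u₁ ∈ ⟦ U ⟧ → u₂ ∈ ⟦ U ⟧ → u₁ ≢ u₂ → Avoids r u₁ V → AdmissibleEnds U V A B r
admissibleEnds-avoiding {V = v₁ , v₂} {A} {B} {r} {u₁} {u₂} dV dA dB u₁∈ u₂∈ u₁≢u₂ r-ok
  with forced A u₁ ≟ₘ just v₁ | forced B u₁ ≟ₘ just v₁ | forced A u₁ ≟ₘ just v₂ | forced B u₁ ≟ₘ just v₂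
... | no A₁ | no B₁ | _     | _     = ends u₁ v₁ u₁∈ (here refl) A₁ B₁ (r-ok (here refl))
... | _     | _     | no A₂ | no B₂ = ends u₁ v₂ u₁∈ (there (here refl)) A₂ B₂ (r-ok (there (here refl)))
... | yes A₁ | _     | yes A₂ | _     = contradiction (just-injective (trans (sym A₁) A₂)) dV
... | _      | yes B₁ | _      | yes B₂ = contradiction (just-injective (trans (sym B₁) B₂)) dV
... | yes A₁ | _      | _      | yes B₂ = admissibleEnds-at {r = r} dV u₂∈
  (forced-cross dA dB u₁≢u₂ A₁ B₂) (avoids-swap {forced B} (forced-cross dB dA u₁≢u₂ B₂ A₁))
... | _      | yes B₁ | yes A₂ | _      = admissibleEnds-at {r = r} dV u₂∈
  (avoids-swap {forced A} (forced-cross dA dB u₁≢u₂ A₂ B₁)) (forced-cross dB dA u₁≢u₂ B₁ A₂)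

-- r swaps U when it forces at both colours of U.  Then a colour of U lying in V can be used at both
-- ends, and otherwise r u₁ = u₂ avoids V.
admissibleEnds : ∀ {U V A B r} → Distinct U → Distinct V → Distinct A → Distinct B →
  (∀ {d₁ d₂} → r (proj₁ U) ≡ just d₁ → r (proj₂ U) ≡ just d₂ → (d₁ , d₂) ≡ swap U) →
  AdmissibleEnds U V A B r
admissibleEnds {u₁ , u₂} {V} {A} {B} {r} dU dV dA dB swaps with r u₁ in e₁ | r u₂ in e₂
... | nothing | _       = admissibleEnds-avoiding dV dA dB (here refl) (there (here refl)) dU
  (λ _ r→y → case trans (sym e₁) r→y of λ ())
... | just _  | nothing = admissibleEnds-avoiding dV dA dB (there (here refl)) (here refl) (dU ∘ sym)
  (λ _ r→y → case trans (sym e₂) r→y of λ ())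
... | just d₁ | just d₂ with swaps refl refl
...   | refl with u₁ ∈? ⟦ V ⟧ | u₂ ∈? ⟦ V ⟧
...     | yes u₁∈V | _        = ends u₁ u₁ (here refl) u₁∈V (forced-irreflexive dA) (forced-irreflexive dB)
  (dU ∘ sym ∘ just-injective ∘ trans (sym e₁))
...     | no _     | yes u₂∈V = ends u₂ u₂ (there (here refl)) u₂∈V (forced-irreflexive dA) (forced-irreflexive dB)
  (dU ∘ just-injective ∘ trans (sym e₂))
...     | no u₁∉V  | no u₂∉V  = admissibleEnds-avoiding dV dA dB (here refl) (there (here refl)) dU
  (λ y∈ r→y → u₂∉V (subst (_∈ ⟦ V ⟧) (sym (just-injective (trans (sym e₁) r→y))) y∈))

-- The graph Θ(2,2,m+1)

EdgesProper : ∀ {N} → Vec ℕ N → List (Fin N × Fin N) → Set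
EdgesProper f = All (λ e → lookup f (proj₁ e) ≢ lookup f (proj₂ e))

pathEdges-proper : ∀ {N} (f : Vec ℕ N) s ys t →
  EdgesProper f (pathEdges s ys t) ⇔ ProperPath (lookup f s) (map (lookup f) ys) (lookup f t)
pathEdges-proper f s ys t = mk⇔ (to s ys) (from s ys)
  where
    to : ∀ s ys → EdgesProper f (pathEdges s ys t) → ProperPath (lookup f s) (map (lookup f) ys) (lookup f t)
    to s []       (s≢t ∷ []) = s≢t
    to s (y ∷ ys) (s≢y ∷ ps) = s≢y , to y ys ps
    from : ∀ s ys → ProperPath (lookup f s) (map (lookup f) ys) (lookup f t) → EdgesProper f (pathEdges s ys t)
    from s []       s≢t         = s≢t ∷ []
    from s (y ∷ ys) (s≢y , ps) = s≢y ∷ from y ys ps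

fin-zero : ∀ {m} → fin {m} 0 ≡ zero
fin-zero {zero}  = refl
fin-zero {suc m} = refl

applyUpTo-lookup : ∀ {m} c (xs : Vec ℕ m) → applyUpTo (λ i → lookup (c ∷ xs) (fin (suc i))) m ≡ toList xs
applyUpTo-lookup c []                = refl
applyUpTo-lookup {suc m} c (x ∷ xs) = cong₂ _∷_ (cong (lookup (x ∷ xs)) (fin-zero {m})) (applyUpTo-lookup x xs)

long-path-colors : ∀ {m} cu cv ca cb (xs : Vec ℕ m) →
  map (lookup (cu ∷ cv ∷ ca ∷ cb ∷ xs)) (map (λ i → fin (4 + i)) (upTo m)) ≡ toList xs
long-path-colors {m} cu cv ca cb xs = begin
  map (lookup f) (map (λ i → fin (4 + i)) (upTo m)) ≡⟨ map-∘ (upTo m) ⟨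
  map (lookup f ∘ λ i → fin (4 + i)) (upTo m)       ≡⟨ map-applyUpTo (λ i → i) _ m ⟩
  applyUpTo (λ i → lookup (cb ∷ xs) (fin (suc i))) m ≡⟨ applyUpTo-lookup cb xs ⟩
  toList xs ∎
  where
    open ≡-Reasoning
    f = cu ∷ cv ∷ ca ∷ cb ∷ xs

Θ₂₂-proper : ∀ {m} cu cv ca cb (xs : Vec ℕ m) →
  Proper (Theta 2 2 (suc m)) (cu ∷ cv ∷ ca ∷ cb ∷ xs) ⇔
  (ProperPath cu (ca ∷ []) cv × ProperPath cu (cb ∷ []) cv × ProperPath cu (toList xs) cv)
Θ₂₂-proper {m} cu cv ca cb xs = mk⇔ to from
  where
    f : Vec ℕ (4 + m)
    f = cu ∷ cv ∷ ca ∷ cb ∷ xs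
    block : List (Fin (4 + m))
    block = map (λ i → fin (4 + i)) (upTo m)
    long : EdgesProper f (pathEdges zero block (suc zero)) ⇔ ProperPath cu (map (lookup f) block) cv
    long = pathEdges-proper f zero block (suc zero)
    b-color : lookup (cb ∷ xs) (fin 0) ≡ cb
    b-color = cong (lookup (cb ∷ xs)) (fin-zero {m})
    to : Proper (Theta 2 2 (suc m)) f →
         ProperPath cu (ca ∷ []) cv × ProperPath cu (cb ∷ []) cv × ProperPath cu (toList xs) cv
    to (u≢a ∷ a≢v ∷ u≢b ∷ b≢v ∷ ps) =
      (u≢a , a≢v) ,
      subst (λ c → ProperPath cu (c ∷ []) cv) b-color (u≢b , b≢v) ,
      subst (λ l → ProperPath cu l cv) (long-path-colors cu cv ca cb xs) (Equivalence.to long ps)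
    from : ProperPath cu (ca ∷ []) cv × ProperPath cu (cb ∷ []) cv × ProperPath cu (toList xs) cv →
           Proper (Theta 2 2 (suc m)) f
    from ((u≢a , a≢v) , path-b , path) =
      let u≢b , b≢v = subst (λ c → ProperPath cu (c ∷ []) cv) (sym b-color) path-b
      in u≢a ∷ a≢v ∷ u≢b ∷ b≢v ∷
         Equivalence.from long (subst (λ l → ProperPath cu l cv) (sym (long-path-colors cu cv ca cb xs)) path)

module _ {m} (odd : Odd m) (Ps : Fin (4 + m) → Pair) (dPs : ∀ v → Distinct (Ps v)) where

  private
    U V A B : Pair
    U = Ps zero
    V = Ps (suc zero)
    A = Ps (suc (suc zero))
    B = Ps (suc (suc (suc zero)))

    Ls : Fin m → Pair
    Ls w = Ps (suc (suc (suc (suc w))))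

    dLs : ∀ w → Distinct (Ls w)
    dLs w = dPs (suc (suc (suc (suc w))))

    long-swaps : ∀ {d₁ d₂} → forbidden Ls (proj₁ U) ≡ just d₁ → forbidden Ls (proj₂ U) ≡ just d₂ →
                 (d₁ , d₂) ≡ swap U
    long-swaps e₁ e₂ = trans (forbidden-swapⁿ Ls dLs (dPs zero) e₁ e₂) (swapⁿ-odd odd U)

  Θ₂₂-pair-colorable : IsLColorable (Theta 2 2 (suc m)) (⟦_⟧ ∘ Ps)
  Θ₂₂-pair-colorable
    with admissibleEnds {U} {V} {A} {B} {forbidden Ls}
           (dPs zero) (dPs (suc zero)) (dPs (suc (suc zero))) (dPs (suc (suc (suc zero)))) long-swaps
  ... | ends x y x∈U y∈V A-ok B-ok r-ok
    with forced-complete (dPs (suc (suc zero))) A-ok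
       | forced-complete (dPs (suc (suc (suc zero)))) B-ok
       | forbidden-complete Ls dLs r-ok
  ... | ca , ca∈ , path-a | cb , cb∈ , path-b | xs , xs∈ , path =
    x ∷ y ∷ ca ∷ cb ∷ xs , chosen , Equivalence.from (Θ₂₂-proper x y ca cb xs) (path-a , path-b , path)
    where
      chosen : ∀ v → lookup (x ∷ y ∷ ca ∷ cb ∷ xs) v ∈ ⟦ Ps v ⟧
      chosen zero                      = x∈U
      chosen (suc zero)                = y∈V
      chosen (suc (suc zero))          = ca∈
      chosen (suc (suc (suc zero)))    = cb∈
      chosen (suc (suc (suc (suc w)))) = xs∈ w

Θ₂₂-choosable : ∀ {m} → Odd m → Choosable (Theta 2 2 (suc m)) 2
Θ₂₂-choosable odd = choosable-by-pairs _ (Θ₂₂-pair-colorable odd)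

Θ₂₂-edge : ∀ {m} → (zero , suc (suc zero)) ∈ edges (Theta 2 2 (suc m))
Θ₂₂-edge = here refl

-- A list assignment of Θ(2,2,2k) with a single colouring

-- From colour 1 the long path is forced through 2, 3, 1 and then alternates, so it forbids 1 at v.
rigidPathLists : ∀ {n} → Fin (3 + n) → Pair
rigidPathLists zero                   = 1 , 2
rigidPathLists (suc zero)             = 2 , 3
rigidPathLists (suc (suc zero))       = 3 , 1
rigidPathLists (suc (suc (suc _)))    = 1 , 2

rigidLists : ∀ t → Fin (7 + 2 * t) → Pair
rigidLists t zero                          = 1 , 2
rigidLists t (suc zero)                    = 1 , 3
rigidLists t (suc (suc zero))              = 1 , 2
rigidLists t (suc (suc (suc zero)))        = 2 , 3
rigidLists t (suc (suc (suc (suc w))))     = rigidPathLists w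

rigidPathLists-distinct : ∀ {n} w → Distinct (rigidPathLists {n} w)
rigidPathLists-distinct zero                = λ ()
rigidPathLists-distinct (suc zero)          = λ ()
rigidPathLists-distinct (suc (suc zero))    = λ ()
rigidPathLists-distinct (suc (suc (suc _))) = λ ()

rigidLists-distinct : ∀ t v → Distinct (rigidLists t v)
rigidLists-distinct t zero                      = λ ()
rigidLists-distinct t (suc zero)                = λ ()
rigidLists-distinct t (suc (suc zero))          = λ ()
rigidLists-distinct t (suc (suc (suc zero)))    = λ ()
rigidLists-distinct t (suc (suc (suc (suc w)))) = rigidPathLists-distinct w

forbidden-rigidPath : ∀ t → forbidden (rigidPathLists {2 * t}) 1 ≡ just 1
forbidden-rigidPath t = trans (forbidden-constant (2 * t) refl refl) (cong (just ∘ proj₁) (swapⁿ-even t (1 , 2)))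

rigid-ends : ∀ {cu cv ca cb} → cu ∈ ⟦ 1 , 2 ⟧ → cv ∈ ⟦ 1 , 3 ⟧ → ca ∈ ⟦ 1 , 2 ⟧ → cb ∈ ⟦ 2 , 3 ⟧ →
  ProperPath cu (ca ∷ []) cv → ProperPath cu (cb ∷ []) cv → (cu , cv) ≢ (1 , 1) →
  cu ≡ 1 × cv ≡ 3 × ca ≡ 2 × cb ≡ 2
rigid-ends (here refl) (here refl) _ _ _ _ u,v≢1,1 = contradiction refl u,v≢1,1
rigid-ends (here refl) (there (here refl)) (here refl) _ (u≢a , _) _ _ = contradiction refl u≢a
rigid-ends (here refl) (there (here refl)) (there (here refl)) (here refl) _ _ _ = refl , refl , refl , refl
rigid-ends (here refl) (there (here refl)) (there (here refl)) (there (here refl)) _ (_ , b≢v) _ =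
  contradiction refl b≢v
rigid-ends (there (here refl)) _ (there (here refl)) _ (u≢a , _) _ _ = contradiction refl u≢a
rigid-ends (there (here refl)) (here refl) (here refl) _ (_ , a≢v) _ _ = contradiction refl a≢v
rigid-ends (there (here refl)) (there (here refl)) (here refl) (here refl) _ (u≢b , _) _ = contradiction refl u≢b
rigid-ends (there (here refl)) (there (here refl)) (here refl) (there (here refl)) _ (_ , b≢v) _ =
  contradiction refl b≢v

module _ (t : ℕ) where

  private
    G : Graph
    G = Theta 2 2 (4 + 2 * t)

    L : ListAssignment G
    L = ⟦_⟧ ∘ rigidLists t

  rigid-shape : ∀ {f} → LColoring G L f →
    Σ (PathColoring rigidPathLists 1 3) λ p → f ≡ 1 ∷ 3 ∷ 2 ∷ 2 ∷ proj₁ p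
  rigid-shape {cu ∷ cv ∷ ca ∷ cb ∷ xs} (f∈ , proper) with Equivalence.to (Θ₂₂-proper cu cv ca cb xs) proper
  ... | path-a , path-b , path
    with rigid-ends (f∈ zero) (f∈ (suc zero)) (f∈ (suc (suc zero))) (f∈ (suc (suc (suc zero))))
                    path-a path-b long-ok
    where
      long-ok : (cu , cv) ≢ (1 , 1)
      long-ok refl = forbidden-sound rigidPathLists rigidPathLists-distinct
        (xs , (λ w → f∈ (suc (suc (suc (suc w))))) , path) (forbidden-rigidPath t)
  ... | refl , refl , refl , refl = (xs , (λ w → f∈ (suc (suc (suc (suc w))))) , path) , refl

  rigid-unique : ∀ {f g} → LColoring G L f → LColoring G L g → f ≡ g
  rigid-unique {f} {g} f-col g-col with rigid-shape {f} f-col | rigid-shape {g} g-col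
  ... | p , refl | q , refl =
    cong (λ ys → 1 ∷ 3 ∷ 2 ∷ 2 ∷ ys)
      (PathColoring-unique rigidPathLists rigidPathLists-distinct (forbidden-rigidPath t) p q)

  rigid-assignment : PℓBelow G 2 (P G 2)
  rigid-assignment = L , (λ v → refl , pair-unique (rigidLists-distinct t v)) ,
    <-≤-trans (s≤s (P-list≤1 G L (pair-unique ∘ rigidLists-distinct t) rigid-unique))
              (2≤P G zero (choosable⇒colorable G (Θ₂₂-choosable (odd-3+2* t))))

2*[2+t]≡4+2*t : ∀ t → 2 * (2 + t) ≡ 4 + 2 * t
2*[2+t]≡4+2*t t = trans (*-suc 2 (suc t)) (cong (2 +_) (*-suc 2 t))

mainTheorem6 : (k : ℕ) → 2 ≤ k →
    IsChromaticNumber (Theta 2 2 (2 * k)) 2 ×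
    IsListChromaticNumber (Theta 2 2 (2 * k)) 2 ×
    PℓBelow (Theta 2 2 (2 * k)) 2 (P (Theta 2 2 (2 * k)) 2)
mainTheorem6 (suc (suc t)) (s≤s (s≤s _)) =
  subst Claim (sym (2*[2+t]≡4+2*t t))
    (chromatic-number-2 G Θ₂₂-edge (choosable⇒colorable G choosable) ,
     list-chromatic-number-2 G Θ₂₂-edge choosable ,
     rigid-assignment t)
  where
    Claim : ℕ → Set
    Claim l = IsChromaticNumber (Theta 2 2 l) 2 × IsListChromaticNumber (Theta 2 2 l) 2 ×
              PℓBelow (Theta 2 2 l) 2 (P (Theta 2 2 l) 2)
    G : Graph
    G = Theta 2 2 (4 + 2 * t)
    choosable : Choosable G 2
    choosable = Θ₂₂-choosable (odd-3+2* t)
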